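{- Let $\mathsf{T}:\mathsf{Krip}\to\mathsf{Pos}$ be a functor and $\Lambda$ a set of predicate liftings for $\mathsf{T}$. If $f:\mathcal{M}\to\mathcal{M}'$ is an $(\mathsf{i},\mathsf{T})$-model morphism, then for every state $x$ of $\mathcal{M}$ and every $\phi\in\mathcal{L}(\Lambda)$, $\mathcal{M},x\Vdash\phi$ iff $\mathcal{M}',f(x)\Vdash\phi$.
   Context: $\mathsf{Krip}$ is the category of posets and p-morphisms (order-preserving $f$ such that $f(x)\le' y'$ implies some $y\ge x$ has $f(y)=y'$), $\mathsf{Pos}$ the category of posets and order-preserving maps, $\mathsf{i}$ the inclusion. An $(\mathsf{i},\mathsf{T})$-dialgebra is $(X,\le,\gamma)$ with $\gamma:(X,\le)\to\mathsf{T}(X,\le)$ order-preserving; a dialgebra morphism is a p-morphism $f$ with $\mathsf{T}f\circ\gamma=\gamma'\circ f$. $\mathrm{Up}(X,\le)$ is the set of upsets. An $n$-ary predicate lifting is a family $\lambda_{(X,\le)}:\mathrm{Up}(X,\le)^n\to\mathrm{Up}(\mathsf{T}(X,\le))$ with $\lambda_{(X,\le)}(f^{ -1}(a_1),\dots,f^{ -1}(a_n))=(\mathsf{T}f)^{ -1}(\lambda_{(X',\le')}(a_1,\dots,a_n))$ for all p-morphisms $f$. $\mathcal{L}(\Lambda)$: $\phi::=\top\mid\bot\mid p\mid\phi\wedge\phi\mid\phi\vee\phi\mid\phi\to\phi\mid\heartsuit^\lambda(\phi_1,\dots,\phi_n)$ with $p$ from a countably infinite set $\mathrm{Prop}$.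 An $(\mathsf{i},\mathsf{T})$-model is $\mathcal{M}=(X,\le,\gamma,V)$ with $V:\mathrm{Prop}\to\mathrm{Up}(X,\le)$; truth: $\top$ always, $\bot$ never, $p$ iff $x\in V(p)$, $\wedge,\vee$ as usual, $x\Vdash\phi\to\psi$ iff every $y\ge x$ satisfying $\phi$ satisfies $\psi$, $x\Vdash\heartsuit^\lambda(\phi_1,\dots,\phi_n)$ iff $\gamma(x)\in\lambda_{(X,\le)}([\![\phi_1]\!],\dots,[\![\phi_n]\!])$ with $[\![\phi]\!]$ the truth set. An $(\mathsf{i},\mathsf{T})$-model morphism $(X,\le,\gamma,V)\to(X',\le',\gamma',V')$ is a dialgebra morphism $f$ with $V(p)=f^{ -1}(V'(p))$ for all $p$. -}

module Defs where

open import Data.Nat using (ℕ)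
open import Data.Fin using (Fin)
open import Data.Product using (Σ; _×_; _,_; proj₁; proj₂)
open import Data.Sum using (_⊎_; inj₁; inj₂)
open import Data.Empty using (⊥)
open import Data.Unit using (⊤; tt)
open import Function using (_∘_; id)
open import Function.Bundles using (_⇔_)
open import Relation.Binary.PropositionalEquality using (_≡_)
open import Relation.Binary.Structures using (IsPartialOrder)

record Poset : Set₁ where
  field
    Carrier : Set
    _≤_     : Carrier → Carrier → Set
    isPartialOrder : IsPartialOrder _≡_ _≤_
  open IsPartialOrder isPartialOrder public using (refl; trans; antisym)

open Poset

record MonoMap (X Y : Poset) : Set where
  field
    fun  : Carrier X → Carrier Y
    mono : ∀ {x y} → _≤_ X x y → _≤_ Y (fun x) (fun y)

record PMorphism (X Y : Poset) : Set where
  field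
    fun  : Carrier X → Carrier Y
    mono : ∀ {x y} → _≤_ X x y → _≤_ Y (fun x) (fun y)
    back : ∀ {x y'} → _≤_ Y (fun x) y' →
           Σ (Carrier X) (λ y → _≤_ X x y × fun y ≡ y')

open MonoMap
open PMorphism

idP : (X : Poset) → PMorphism X X
idP X = record { fun = id ; mono = id ; back = λ {x} {y'} p → y' , p , Relation.Binary.PropositionalEquality.refl }

_∘P_ : {X Y Z : Poset} → PMorphism Y Z → PMorphism X Y → PMorphism X Z
_∘P_ {X} {Y} {Z} g f = record
  { fun  = fun g ∘ fun f
  ; mono = mono g ∘ mono f
  ; back = λ {x} p →
      let (y₁ , fx≤y₁ , gy₁≡) = back g p
          (y₂ , x≤y₂ , fy₂≡) = back f fx≤y₁
      in y₂ , x≤y₂ , Relation.Binary.PropositionalEquality.trans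
                       (Relation.Binary.PropositionalEquality.cong (fun g) fy₂≡) gy₁≡
  }

-- Functors T : Krip → Pos (morphism equality is pointwise equality)

record Functor : Set₁ where
  field
    obj     : Poset → Poset
    fmap    : {X Y : Poset} → PMorphism X Y → MonoMap (obj X) (obj Y)
    fmap-cong : {X Y : Poset} (f g : PMorphism X Y) →
                (∀ x → fun f x ≡ fun g x) →
                ∀ t → fun (fmap f) t ≡ fun (fmap g) t
    fmap-id : (X : Poset) → ∀ t → fun (fmap (idP X)) t ≡ t
    fmap-∘  : {X Y Z : Poset} (g : PMorphism Y Z) (f : PMorphism X Y) →
              ∀ t → fun (fmap (g ∘P f)) t ≡ fun (fmap g) (fun (fmap f) t)

open Functor

record Upset (X : Poset) : Set₁ where
  field
    mem : Carrier X → Set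
    up  : ∀ {x y} → _≤_ X x y → mem x → mem y

open Upset

preimage : {X Y : Poset} → PMorphism X Y → Upset Y → Upset X
preimage f a = record { mem = mem a ∘ fun f ; up = λ p → up a (mono f p) }

-- n-ary predicate liftings for T.
-- Equality of upsets is extensional (same members); `resp` records that
-- λ is a function on upsets-as-sets (automatic in set theory).

Tpreimage : (T : Functor) {X X' : Poset} → PMorphism X X' → Upset (obj T X') → Upset (obj T X)
Tpreimage T f b = record { mem = mem b ∘ fun (fmap T f) ; up = λ p → up b (mono (fmap T f) p) }

record PredLifting (T : Functor) (n : ℕ) : Set₁ where
  field
    lift : (X : Poset) → (Fin n → Upset X) → Upset (obj T X)
    resp : (X : Poset) (a b : Fin n → Upset X) →
           (∀ i x → mem (a i) x ⇔ mem (b i) x) →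
           ∀ t → mem (lift X a) t ⇔ mem (lift X b) t
    natural : {X X' : Poset} (f : PMorphism X X') (a : Fin n → Upset X') →
              ∀ t → mem (lift X (λ i → preimage f (a i))) t
                    ⇔ mem (Tpreimage T f (lift X' a)) t

open PredLifting

record Liftings (T : Functor) : Set₁ where
  field
    Idx   : Set
    arity : Idx → ℕ
    λ[_]  : (l : Idx) → PredLifting T (arity l)

open Liftings

data Formula {T : Functor} (Λ : Liftings T) : Set where
  ⊤'  : Formula Λ
  ⊥'  : Formula Λ
  var : ℕ → Formula Λ
  _∧'_ _∨'_ _⇒'_ : Formula Λ → Formula Λ → Formula Λ
  ♡   : (l : Idx Λ) → (Fin (arity Λ l) → Formula Λ) → Formula Λ

record Model (T : Functor) : Set₁ where
  field
    poset : Poset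
    γ     : MonoMap poset (obj T poset)
    V     : ℕ → Upset poset

open Model

record DialgebraMorphism (T : Functor) (X X' : Poset)
    (γ : MonoMap X (obj T X)) (γ' : MonoMap X' (obj T X')) : Set where
  field
    pmor : PMorphism X X'
    comm : ∀ x → fun (fmap T pmor) (fun γ x) ≡ fun γ' (fun pmor x)

record ModelMorphism (T : Functor) (M M' : Model T) : Set₁ where
  field
    dmor : DialgebraMorphism T (poset M) (poset M') (γ M) (γ M')
    valuation : ∀ (p : ℕ) x →
      mem (V M p) x ⇔ mem (V M' p) (fun (DialgebraMorphism.pmor dmor) x)

module _ {T : Functor} (Λ : Liftings T) (M : Model T) where
  private
    X = poset M

  mutual
    _⊩_ : Carrier X → Formula Λ → Set
    x ⊩ ⊤' = ⊤
    x ⊩ ⊥' = ⊥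
    x ⊩ var p = mem (V M p) x
    x ⊩ (φ ∧' ψ) = (x ⊩ φ) × (x ⊩ ψ)
    x ⊩ (φ ∨' ψ) = (x ⊩ φ) ⊎ (x ⊩ ψ)
    x ⊩ (φ ⇒' ψ) = ∀ y → _≤_ X x y → y ⊩ φ → y ⊩ ψ
    x ⊩ ♡ l φs = mem (lift (λ[ Λ ] l) X (λ i → ⟦ φs i ⟧)) (fun (γ M) x)

    persist : (φ : Formula Λ) → ∀ {x y} → _≤_ X x y → x ⊩ φ → y ⊩ φ
    persist ⊤' p h = tt
    persist ⊥' p ()
    persist (var q) p h = up (V M q) p h
    persist (φ ∧' ψ) p (h₁ , h₂) = persist φ p h₁ , persist ψ p h₂
    persist (φ ∨' ψ) p (inj₁ h) = inj₁ (persist φ p h)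
    persist (φ ∨' ψ) p (inj₂ h) = inj₂ (persist ψ p h)
    persist (φ ⇒' ψ) p h z y≤z = h z (trans X p y≤z)
    persist (♡ l φs) p h = up (lift (λ[ Λ ] l) X (λ i → ⟦ φs i ⟧)) (mono (γ M) p) h

    ⟦_⟧ : Formula Λ → Upset X
    ⟦ φ ⟧ = record { mem = λ x → x ⊩ φ ; up = persist φ }

Sat : {T : Functor} (Λ : Liftings T) (M : Model T) → Carrier (poset M) → Formula Λ → Set
Sat Λ M x φ = _⊩_ Λ M x φ

mfun : {T : Functor} {M M' : Model T} → ModelMorphism T M M' → Carrier (poset M) → Carrier (poset M')
mfun f = fun (DialgebraMorphism.pmor (ModelMorphism.dmor f))

-- Propositional connectives other than → are
-- evaluated pointwise and commute with any map. Implication quantifies over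
-- the upset of a state: the forth condition of a p-morphism carries
-- successors of x to successors of f x, and the back condition lifts every
-- successor of f x to one of x. For a modality, the induction hypothesis says
-- that the truth sets in M are the preimages of those in M', so naturality of
-- the predicate lifting moves the condition along T f, and the dialgebra
-- square T f ∘ γ = γ' ∘ f identifies T f (γ x) with γ' (f x).
module Submission where

open import Data.Fin using (Fin)
open import Data.Nat using (ℕ)
open import Data.Product using (_,_)
open import Data.Product.Function.NonDependent.Propositional using (_×-⇔_)
open import Data.Sum.Function.Propositional using (_⊎-⇔_)
open import Function.Bundles using (_⇔_; mk⇔; Equivalence)
open import Function.Construct.Identity using (⇔-id)
open import Function.Properties.Equivalence using (⇔-setoid)
open import Level using (0ℓ)
open import Relation.Binary.PropositionalEquality using (refl; cong)

open import Defs

open Poset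
open PMorphism
open MonoMap
open Upset
open PredLifting
open Liftings

module _ {X Y : Poset} (f : PMorphism X Y) where

  ⇒-invariant : {P Q : Carrier X → Set} {P' Q' : Carrier Y → Set} →
    (∀ x → P x ⇔ P' (fun f x)) → (∀ x → Q x ⇔ Q' (fun f x)) →
    ∀ x → (∀ y → _≤_ X x y → P y → Q y)
        ⇔ (∀ y' → _≤_ Y (fun f x) y' → P' y' → Q' y')
  ⇒-invariant {P} {Q} {P'} {Q'} P⇔P' Q⇔Q' x = mk⇔ preserve reflect
    where
    open Equivalence

    preserve : (∀ y → _≤_ X x y → P y → Q y) →
               ∀ y' → _≤_ Y (fun f x) y' → P' y' → Q' y'
    preserve h y' fx≤y' p' with back f fx≤y'
    ... | y , x≤y , refl = to (Q⇔Q' y) (h y x≤y (from (P⇔P' y) p'))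

    reflect : (∀ y' → _≤_ Y (fun f x) y' → P' y' → Q' y') →
              ∀ y → _≤_ X x y → P y → Q y
    reflect h y x≤y p = from (Q⇔Q' y) (h (fun f y) (mono f x≤y) (to (P⇔P' y) p))

module _ {T : Functor} {X X' : Poset}
         {γ : MonoMap X (Functor.obj T X)} {γ' : MonoMap X' (Functor.obj T X')}
         (g : DialgebraMorphism T X X' γ γ') where
  open DialgebraMorphism g

  lift-invariant : {n : ℕ} (L : PredLifting T n)
    {a : Fin n → Upset X} {a' : Fin n → Upset X'} →
    (∀ i x → mem (a i) x ⇔ mem (a' i) (fun pmor x)) →
    ∀ x → mem (lift L X a) (fun γ x) ⇔ mem (lift L X' a') (fun γ' (fun pmor x))
  lift-invariant L {a} {a'} a⇔a' x = begin
    mem (lift L X a) (fun γ x)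
      ≈⟨ resp L X a (λ i → preimage pmor (a' i)) a⇔a' (fun γ x) ⟩
    mem (lift L X (λ i → preimage pmor (a' i))) (fun γ x)
      ≈⟨ natural L pmor a' (fun γ x) ⟩
    mem (lift L X' a') (fun (Functor.fmap T pmor) (fun γ x))
      ≡⟨ cong (mem (lift L X' a')) (comm x) ⟩
    mem (lift L X' a') (fun γ' (fun pmor x))
      ∎
    where open import Relation.Binary.Reasoning.Setoid (⇔-setoid 0ℓ)

proposition3p8 : (T : Functor) (Λ : Liftings T) (M M' : Model T)
    (f : ModelMorphism T M M') →
    ∀ (x : Poset.Carrier (Model.poset M)) (φ : Formula Λ) →
    Sat Λ M x φ ⇔ Sat Λ M' (mfun f x) φ
proposition3p8 T Λ M M' f = invariant
  where
  open ModelMorphism f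
  open DialgebraMorphism dmor

  invariant : ∀ x φ → Sat Λ M x φ ⇔ Sat Λ M' (mfun f x) φ
  invariant x ⊤'       = ⇔-id _
  invariant x ⊥'       = ⇔-id _
  invariant x (var p)  = valuation p x
  invariant x (φ ∧' ψ) = invariant x φ ×-⇔ invariant x ψ
  invariant x (φ ∨' ψ) = invariant x φ ⊎-⇔ invariant x ψ
  invariant x (φ ⇒' ψ) =
    ⇒-invariant pmor (λ y → invariant y φ) (λ y → invariant y ψ) x
  invariant x (♡ l φs) =
    lift-invariant dmor (λ[ Λ ] l) (λ i y → invariant y (φs i)) x
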